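{- Let $k$ be a positive integer with $4\mid k$, and let $p$ be a prime with $p \equiv 7 \pmod 8$. Let $n$ be a positive integer with $n\equiv 1 \pmod 8$ and $n<p$, such that either $n=1$ or every prime factor of $n$ is congruent to $1 \pmod 4$. Then there are no positive integers $x,y,z$ with $x^2+y^2+z^k=(np)^2$. -}

module Defs where

{-# OPTIONS --safe #-}
module Submission where

-- Write z^k = w⁴ and N = n p. Then x² + y² = N² − w⁴ = A (A + 2w²) with A = N − w². As N ≡ 7 and
-- w² ≡ 0, 1 or 4 (mod 8), either A ≡ 3 (mod 4) or A = 2a with a ≡ 3 (mod 4). A prime q ≡ 3 (mod 4)
-- dividing both factors divides w and N; it cannot divide n, and q = p is impossible as 0 < w < p.
-- But a b is never a sum of two squares when a ≡ 3 (mod 4) and a, b share no prime ≡ 3 (mod 4):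
-- a has a prime factor q ≡ 3 (mod 4), which by Fermat's little theorem divides both roots, so q² ∣ a
-- and we descend to a / q² ≡ a (mod 4).

open import Defs
open import Data.Empty using (⊥; ⊥-elim)
open import Data.Fin using (Fin; zero; suc; fromℕ; inject₁)
open import Data.Fin.Properties using (toℕ-fromℕ; toℕ-inject₁; toℕ<n)
open import Data.List using (_∷_; [])
import Data.List.Relation.Unary.All as All
open import Data.List.Relation.Unary.Any using (here; there)
open import Data.List.Membership.Propositional using (_∈_)
open import Data.Nat
open import Data.Nat.Combinatorics using (_C_; nCn≡1; nC1≡n; nCk+nC[k+1]≡[n+1]C[k+1])
open import Data.Nat.Divisibility
open import Data.Nat.DivMod
open import Data.Nat.Induction using (<-rec)
open import Data.Nat.ListAction using (product)
open import Data.Nat.ListAction.Properties using (∈⇒∣product)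
open import Data.Nat.Primality
open import Data.Nat.Primality.Factorisation using (factorise)
open import Data.Nat.Properties
open import Data.Nat.Tactic.RingSolver using (solve; solve-∀)
open import Data.Product using (_×_; _,_; ∃-syntax)
open import Data.Sum using (_⊎_; inj₁; inj₂; fromInj₁; fromInj₂; reduce)
open import Function using (_∘_)
open import Relation.Binary.PropositionalEquality
open import Relation.Nullary using (¬_; contradiction; yes; no)

open import Algebra.Definitions.RawSemiring +-*-rawSemiring using () renaming (_^_ to _^ₛ_; _×_ to _×ₛ_)
open import Algebra.Properties.CommutativeSemigroup *-commutativeSemigroup using (xy∙z≈xz∙y)
open import Algebra.Properties.CommutativeSemiring.Binomial +-*-commutativeSemiring
  using (binomialTerm) renaming (theorem to binomial-theorem)
open import Algebra.Properties.Monoid.Sum +-0-monoid using (sum; sum-init-last)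

∣m*n∧∤m⇒∣n : ∀ {p m n} → Prime p → p ∣ m * n → ¬ p ∣ m → p ∣ n
∣m*n∧∤m⇒∣n {m = m} {n} p-prime p∣mn p∤m = fromInj₂ (⊥-elim ∘ p∤m) (euclidsLemma m n p-prime p∣mn)

∣m*n∧∤n⇒∣m : ∀ {p m n} → Prime p → p ∣ m * n → ¬ p ∣ n → p ∣ m
∣m*n∧∤n⇒∣m {m = m} {n} p-prime p∣mn p∤n = fromInj₁ (⊥-elim ∘ p∤n) (euclidsLemma m n p-prime p∣mn)

prime∣m*m⇒∣m : ∀ {p m} → Prime p → p ∣ m * m → p ∣ m
prime∣m*m⇒∣m {m = m} p-prime p∣m*m = reduce (euclidsLemma m m p-prime p∣m*m)

m^2≡m*m : ∀ m → m ^ 2 ≡ m * m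
m^2≡m*m m = cong (m *_) (*-identityʳ m)

^ₛ≡^ : ∀ x n → x ^ₛ n ≡ x ^ n
^ₛ≡^ x zero    = refl
^ₛ≡^ x (suc n) = cong (x *_) (^ₛ≡^ x n)

×ₛ≡* : ∀ n x → n ×ₛ x ≡ n * x
×ₛ≡* zero    x = refl
×ₛ≡* (suc n) x = cong (x +_) (×ₛ≡* n x)

∣n⇒∣n×ₛx : ∀ {d n} x → d ∣ n → d ∣ n ×ₛ x
∣n⇒∣n×ₛx {n = n} x d∣n = subst (_ ∣_) (sym (×ₛ≡* n x)) (∣m⇒∣m*n x d∣n)

∣-sum : ∀ {d n} (f : Fin n → ℕ) → (∀ i → d ∣ f i) → d ∣ sum f
∣-sum {n = zero}  f d∣f = _ ∣0
∣-sum {n = suc n} f d∣f = ∣m∣n⇒∣m+n (d∣f zero) (∣-sum (λ i → f (suc i)) (λ i → d∣f (suc i)))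

[1+k]*[1+n]C[1+k]≡[1+n]*nCk : ∀ n k → suc k * (suc n C suc k) ≡ suc n * (n C k)
[1+k]*[1+n]C[1+k]≡[1+n]*nCk zero    zero    = refl
[1+k]*[1+n]C[1+k]≡[1+n]*nCk zero    (suc k) = *-zeroʳ (2 + k)
[1+k]*[1+n]C[1+k]≡[1+n]*nCk (suc n) zero    = trans (+-identityʳ _) (trans (nC1≡n (2 + n)) (sym (*-identityʳ _)))
[1+k]*[1+n]C[1+k]≡[1+n]*nCk (suc n) (suc k) = begin
  (2 + k) * ((2 + n) C (2 + k))                  ≡⟨ cong ((2 + k) *_) (pascal (suc n) (suc k)) ⟨
  (2 + k) * (a + b)                              ≡⟨ *-distribˡ-+ (2 + k) a b ⟩
  (a + (1 + k) * a) + (2 + k) * b                ≡⟨ +-assoc a _ _ ⟩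
  a + ((1 + k) * a + (2 + k) * b)                ≡⟨ cong₂ (λ u v → a + (u + v)) (IH n k) (IH n (suc k)) ⟩
  a + ((1 + n) * (n C k) + (1 + n) * (n C (1 + k))) ≡⟨ cong (a +_) (*-distribˡ-+ (1 + n) (n C k) (n C (1 + k))) ⟨
  a + (1 + n) * (n C k + n C (1 + k))            ≡⟨ cong (λ u → a + (1 + n) * u) (pascal n k) ⟩
  (2 + n) * a                                    ∎
  where
  open ≡-Reasoning
  pascal = nCk+nC[k+1]≡[n+1]C[k+1]
  IH = [1+k]*[1+n]C[1+k]≡[1+n]*nCk
  a = (1 + n) C (1 + k)
  b = (1 + n) C (2 + k)

prime∣pCk : ∀ {n k} → Prime (suc n) → k < n → suc n ∣ suc n C suc k
prime∣pCk {n} {k} p-prime k<n =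
  ∣m*n∧∤m⇒∣n p-prime (divides (n C k) p*[pCk]≡) (λ p∣1+k → <⇒≱ (s≤s k<n) (∣⇒≤ p∣1+k))
  where
  p*[pCk]≡ : suc k * (suc n C suc k) ≡ (n C k) * suc n
  p*[pCk]≡ = trans ([1+k]*[1+n]C[1+k]≡[1+n]*nCk n k) (*-comm (suc n) (n C k))

frobenius : ∀ {m} → Prime (suc m) → ∀ a → ∃[ S ] suc a ^ suc m ≡ a ^ suc m + (S * suc m + 1)
frobenius {m} p-prime a = quotient p∣middle , (begin
  suc a ^ p                                        ≡⟨ ^ₛ≡^ (1 + a) p ⟨
  (1 + a) ^ₛ p                                     ≡⟨ binomial-theorem p 1 a ⟩
  term zero + sum (λ i → term (suc i))
    ≡⟨ cong₂ _+_ first-term (sum-init-last (λ i → term (suc i))) ⟩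
  a ^ p + (middle + term (suc (fromℕ m)))
    ≡⟨ cong₂ (λ u v → a ^ p + (u + v)) (m∣n⇒n≡quotient*m p∣middle) last-term ⟩
  a ^ p + (quotient p∣middle * p + 1)
    ∎)
  where
  open ≡-Reasoning
  p = suc m
  term = binomialTerm 1 a p
  middle = sum (λ i → term (suc (inject₁ i)))
  first-term : term zero ≡ a ^ p
  first-term = trans (+-identityʳ _) (trans (+-identityʳ _) (^ₛ≡^ a p))
  last-term : term (suc (fromℕ m)) ≡ 1
  last-term rewrite toℕ-fromℕ m | nCn≡1 p | n∸n≡0 m =
    trans (+-identityʳ _) (trans (*-identityʳ _) (trans (^ₛ≡^ 1 p) (^-zeroˡ p)))
  p∣middle : p ∣ middle
  p∣middle = ∣-sum (λ i → term (suc (inject₁ i))) λ i →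
    ∣n⇒∣n×ₛx _ (prime∣pCk p-prime (subst (_< m) (sym (toℕ-inject₁ i)) (toℕ<n i)))

fermat : ∀ {m} → Prime (suc m) → ∀ a → ∃[ M ] a ^ suc m ≡ a + M * suc m
fermat p-prime zero    = 0 , refl
fermat {m} p-prime (suc a) with fermat p-prime a | frobenius p-prime a
... | M , a^p≡ | S , [1+a]^p≡ = M + S , (begin
  suc a ^ p                ≡⟨ [1+a]^p≡ ⟩
  a ^ p + (S * p + 1)      ≡⟨ cong (_+ (S * p + 1)) a^p≡ ⟩
  a + M * p + (S * p + 1)  ≡⟨ solve (a ∷ M ∷ S ∷ m ∷ []) ⟩
  suc a + (M + S) * p      ∎)
  where
  open ≡-Reasoning
  p = suc m

fermat-little : ∀ {m a} → Prime (suc m) → ¬ suc m ∣ a → ∃[ A ] suc m ∣ A × a ^ m ≡ suc A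
fermat-little {m} {a} p-prime p∤a with a ^ m in a^m≡ | fermat p-prime a
... | zero  | _ = contradiction (m^n≡0⇒m≡0 a m a^m≡) (λ { refl → p∤a (_ ∣0) })
... | suc A | M , a*[1+A]≡ = A , ∣m*n∧∤m⇒∣n p-prime (divides M a*A≡M*p) p∤a , refl
  where
  a*A≡M*p : a * A ≡ M * suc m
  a*A≡M*p = +-cancelˡ-≡ a _ _ (trans (sym (*-suc a A)) a*[1+A]≡)

odd-power-sum : ∀ u v t → u + v ∣ u ^ (1 + t * 2) + v ^ (1 + t * 2)
odd-power-sum u v zero    = ∣-reflexive (sym (cong₂ _+_ (*-identityʳ u) (*-identityʳ v)))
odd-power-sum u v (suc t) =
  ∣m+n∣m⇒∣n (subst (u + v ∣_) (factor (u ^ (1 + t * 2)) (v ^ (1 + t * 2))) (m∣m*n _))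
            (∣n⇒∣m*n (u * v) (odd-power-sum u v t))
  where
  factor : ∀ a b → (u + v) * (u * a + v * b) ≡ u * v * (a + b) + (u * (u * a) + v * (v * b))
  factor a b = solve (u ∷ v ∷ a ∷ b ∷ [])

≡3[mod4]⇒>2 : ∀ {q} → q % 4 ≡ 3 → 2 < q
≡3[mod4]⇒>2 {suc (suc (suc q))} _ = s≤s (s≤s (s≤s z≤n))

-- If q ∤ m then q ∤ n, so Fermat gives m^(q−1) ≡ n^(q−1) ≡ 1 (mod q); but (q − 1) / 2 is odd,
-- so m² + n² divides m^(q−1) + n^(q−1), whence q ∣ 2.
prime[3+4t]∣m²+n²⇒∣m : ∀ t {m n} → Prime (3 + t * 4) → 3 + t * 4 ∣ m * m + n * n → 3 + t * 4 ∣ m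
prime[3+4t]∣m²+n²⇒∣m t {m} {n} q-prime q∣sum with 3 + t * 4 ∣? m
... | yes q∣m = q∣m
... | no  q∤m = contradiction q∣2 (>⇒∤ (s≤s (s≤s (s≤s z≤n))))
  where
  q = 3 + t * 4
  e = 1 + t * 2
  q∤n : ¬ q ∣ n
  q∤n q∣n = q∤m (prime∣m*m⇒∣m q-prime
    (∣m+n∣m⇒∣n (subst (q ∣_) (+-comm (m * m) (n * n)) q∣sum) (∣m⇒∣m*n n q∣n)))
  square-power : ∀ k → (k * k) ^ e ≡ k ^ (2 + t * 4)
  square-power k = trans (cong (_^ e) (sym (m^2≡m*m k))) (trans (^-*-assoc k 2 e) (cong (k ^_) 2e≡q-1))
    where
    2e≡q-1 : 2 * (1 + t * 2) ≡ 2 + t * 4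
    2e≡q-1 = solve (t ∷ [])
  q∣2 : q ∣ 2
  q∣2 with fermat-little q-prime q∤m | fermat-little q-prime q∤n
  ... | A , q∣A , m^[q-1]≡ | B , q∣B , n^[q-1]≡ =
    ∣m+n∣m⇒∣n (subst (q ∣_) powers≡ q∣powers) (∣m∣n⇒∣m+n q∣A q∣B)
    where
    q∣powers : q ∣ (m * m) ^ e + (n * n) ^ e
    q∣powers = ∣-trans q∣sum (odd-power-sum (m * m) (n * n) t)
    powers≡ : (m * m) ^ e + (n * n) ^ e ≡ A + B + 2
    powers≡ = begin
      (m * m) ^ e + (n * n) ^ e          ≡⟨ cong₂ _+_ (square-power m) (square-power n) ⟩
      m ^ (2 + t * 4) + n ^ (2 + t * 4)  ≡⟨ cong₂ _+_ m^[q-1]≡ n^[q-1]≡ ⟩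
      suc A + suc B                      ≡⟨ solve (A ∷ B ∷ []) ⟩
      A + B + 2                          ∎
      where open ≡-Reasoning

prime≡3[mod4]∣m²+n²⇒∣m∧∣n : ∀ {q m n} → Prime q → q % 4 ≡ 3 → q ∣ m * m + n * n → q ∣ m × q ∣ n
prime≡3[mod4]∣m²+n²⇒∣m∧∣n {q} {m} {n} q-prime q≡3 q∣sum =
  ∣m {m} {n} (subst (_∣ m * m + n * n) q≡3+4t q∣sum) ,
  ∣m {n} {m} (subst (_∣ n * n + m * m) q≡3+4t (subst (q ∣_) (+-comm (m * m) (n * n)) q∣sum))
  where
  q≡3+4t : q ≡ 3 + q / 4 * 4
  q≡3+4t = trans (m≡m%n+[m/n]*n q 4) (cong (_+ q / 4 * 4) q≡3)
  ∣m : ∀ {m n} → 3 + q / 4 * 4 ∣ m * m + n * n → q ∣ m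
  ∣m {m} {n} q∣sum =
    subst (_∣ m) (sym q≡3+4t) (prime[3+4t]∣m²+n²⇒∣m (q / 4) {m} {n} (subst Prime q≡3+4t q-prime) q∣sum)

m*n≡3[mod4]⇒m⊎n≡3[mod4] : ∀ m n → m * n % 4 ≡ 3 → m % 4 ≡ 3 ⊎ n % 4 ≡ 3
m*n≡3[mod4]⇒m⊎n≡3[mod4] m n mn≡3 =
  residues (m % 4) (n % 4) (m%n<n m 4) (m%n<n n 4) (trans (sym (%-distribˡ-* m n 4)) mn≡3)
  where
  residues : ∀ r s → r < 4 → s < 4 → r * s % 4 ≡ 3 → r ≡ 3 ⊎ s ≡ 3
  residues 0 _ _ _ ()
  residues 1 0 _ _ ()
  residues 1 1 _ _ ()
  residues 1 2 _ _ ()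
  residues 1 3 _ _ _ = inj₂ refl
  residues 2 0 _ _ ()
  residues 2 1 _ _ ()
  residues 2 2 _ _ ()
  residues 2 3 _ _ ()
  residues 3 0 _ _ ()
  residues 3 1 _ _ _ = inj₁ refl
  residues 3 2 _ _ ()
  residues 3 3 _ _ ()
  residues (suc (suc (suc (suc _)))) _ (s≤s (s≤s (s≤s (s≤s ())))) _ _
  residues _ (suc (suc (suc (suc _)))) _ (s≤s (s≤s (s≤s (s≤s ())))) _

product≡3[mod4]⇒∃∈ : ∀ ns → product ns % 4 ≡ 3 → ∃[ n ] n ∈ ns × n % 4 ≡ 3
product≡3[mod4]⇒∃∈ []       ()
product≡3[mod4]⇒∃∈ (n ∷ ns) prod≡3 with m*n≡3[mod4]⇒m⊎n≡3[mod4] n (product ns) prod≡3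
... | inj₁ n≡3 = n , here refl , n≡3
... | inj₂ ns≡3 with product≡3[mod4]⇒∃∈ ns ns≡3
...   | m , m∈ns , m≡3 = m , there m∈ns , m≡3

≡3[mod4]⇒∃prime≡3[mod4]∣ : ∀ m → m % 4 ≡ 3 → ∃[ q ] Prime q × q % 4 ≡ 3 × q ∣ m
≡3[mod4]⇒∃prime≡3[mod4]∣ (suc m) m≡3 with factorise (suc m)
... | record { factors = qs ; isFactorisation = m≡∏qs ; factorsPrime = qs-prime }
  with product≡3[mod4]⇒∃∈ qs (subst (λ k → k % 4 ≡ 3) m≡∏qs m≡3)
...   | q , q∈qs , q≡3 =
  q , All.lookup qs-prime q∈qs , q≡3 , subst (q ∣_) (sym m≡∏qs) (∈⇒∣product q∈qs)

NoCommonPrime≡3[mod4] : ℕ → ℕ → Set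
NoCommonPrime≡3[mod4] a b = ∀ {q} → Prime q → q % 4 ≡ 3 → q ∣ a → q ∣ b → ⊥

noCommonPrime-∣ˡ : ∀ {a a′ b} → a′ ∣ a → NoCommonPrime≡3[mod4] a b → NoCommonPrime≡3[mod4] a′ b
noCommonPrime-∣ˡ a′∣a no-common q-prime q≡3 q∣a′ = no-common q-prime q≡3 (∣-trans q∣a′ a′∣a)

noCommonPrime-2*ʳ : ∀ {a b} → NoCommonPrime≡3[mod4] a b → NoCommonPrime≡3[mod4] a (2 * b)
noCommonPrime-2*ʳ no-common q-prime q≡3 q∣a q∣2b =
  no-common q-prime q≡3 q∣a (∣m*n∧∤m⇒∣n q-prime q∣2b (>⇒∤ (≡3[mod4]⇒>2 q≡3)))

[m*q*q]%4≡m%4 : ∀ m {q} → q % 4 ≡ 3 → m * q * q % 4 ≡ m % 4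
[m*q*q]%4≡m%4 m {q} q≡3 = begin
  m * q * q % 4                  ≡⟨ cong (_% 4) (*-assoc m q q) ⟩
  m * (q * q) % 4                ≡⟨ %-distribˡ-* m (q * q) 4 ⟩
  m % 4 * (q * q % 4) % 4        ≡⟨ cong (λ r → m % 4 * r % 4) q*q≡1 ⟩
  m % 4 * 1 % 4                  ≡⟨ cong (_% 4) (*-identityʳ (m % 4)) ⟩
  m % 4 % 4                      ≡⟨ m%n%n≡m%n m 4 ⟩
  m % 4                          ∎
  where
  open ≡-Reasoning
  q*q≡1 : q * q % 4 ≡ 1
  q*q≡1 = trans (%-distribˡ-* q q 4) (cong (λ r → r * r % 4) q≡3)

cancel-common-square : ∀ {q s} a b → Prime q → ¬ q ∣ b → s * q * q ≡ a * q * b →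
                       ∃[ a′ ] a ≡ a′ * q × s ≡ a′ * b
cancel-common-square {q} {s} a b q-prime q∤b sqq≡aqb = a′ , a≡a′q , *-cancelʳ-≡ s (a′ * b) q (begin
  s * q             ≡⟨ sq≡ab ⟩
  a * b             ≡⟨ cong (_* b) a≡a′q ⟩
  a′ * q * b        ≡⟨ xy∙z≈xz∙y a′ q b ⟩
  a′ * b * q        ∎)
  where
  open ≡-Reasoning
  instance _ = prime⇒nonZero q-prime
  sq≡ab : s * q ≡ a * b
  sq≡ab = *-cancelʳ-≡ (s * q) (a * b) q (trans sqq≡aqb (xy∙z≈xz∙y a q b))
  q∣a : q ∣ a
  q∣a = ∣m*n∧∤n⇒∣m q-prime (divides s (sym sq≡ab)) q∤b
  a′ = quotient q∣a
  a≡a′q = m∣n⇒n≡quotient*m q∣a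

m²+n²≢a*b : ∀ m n {a b} → a % 4 ≡ 3 → NoCommonPrime≡3[mod4] a b → m * m + n * n ≢ a * b
m²+n²≢a*b m n {a} {b} = <-rec P descend a m n
  where
  P : ℕ → Set
  P a = ∀ m n → a % 4 ≡ 3 → NoCommonPrime≡3[mod4] a b → m * m + n * n ≢ a * b
  scale-squares : ∀ m n q → (m * m + n * n) * q * q ≡ m * q * (m * q) + n * q * (n * q)
  scale-squares = solve-∀
  descend : ∀ a → (∀ {a′} → a′ < a → P a′) → P a
  descend a rec m n a≡3 no-common sum≡ab with ≡3[mod4]⇒∃prime≡3[mod4]∣ a a≡3
  ... | q , q-prime , q≡3 , q∣a
    with prime≡3[mod4]∣m²+n²⇒∣m∧∣n {m = m} {n} q-prime q≡3 (subst (q ∣_) (sym sum≡ab) (∣m⇒∣m*n b q∣a))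
       | q∣a
  ... | divides m′ refl , divides n′ refl | divides a₁ refl
    with cancel-common-square {s = m′ * m′ + n′ * n′} a₁ b q-prime (no-common q-prime q≡3 q∣a)
                              (trans (scale-squares m′ n′ q) sum≡ab)
  ... | a₂ , refl , m′²+n′²≡a₂b =
    rec a₂<a m′ n′ a₂≡3 (noCommonPrime-∣ˡ (∣m⇒∣m*n q (m∣m*n q)) no-common) m′²+n′²≡a₂b
    where
    instance _ = prime⇒nonZero q-prime
    a₂≡3 : a₂ % 4 ≡ 3
    a₂≡3 = trans (sym ([m*q*q]%4≡m%4 a₂ q≡3)) a≡3
    instance _ = >-nonZero (<-≤-trans (z<s {2}) (≡3[mod4]⇒>2 a₂≡3))
    a₂<a : a₂ < a₂ * q * q
    a₂<a = <-≤-trans (m<m*n a₂ q (<-≤-trans (s≤s (s≤s z≤n)) (≡3[mod4]⇒>2 q≡3))) (m≤m*n (a₂ * q) q)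

square≡0[mod4]⊎1[mod8] : ∀ w → (∃[ t ] w * w ≡ t * 4) ⊎ (∃[ t ] w * w ≡ 1 + t * 8)
square≡0[mod4]⊎1[mod8] w =
  subst (λ v → (∃[ t ] v * v ≡ t * 4) ⊎ (∃[ t ] v * v ≡ 1 + t * 8)) (sym (m≡m%n+[m/n]*n w 4))
        (by-residue (w % 4) (w / 4) (m%n<n w 4))
  where
  by-residue : ∀ r u → r < 4 →
               (∃[ t ] (r + u * 4) * (r + u * 4) ≡ t * 4) ⊎ (∃[ t ] (r + u * 4) * (r + u * 4) ≡ 1 + t * 8)
  by-residue 0 u _ = inj₁ (u * u * 4 , solve (u ∷ []))
  by-residue 1 u _ = inj₂ (u + u * u * 2 , solve (u ∷ []))
  by-residue 2 u _ = inj₁ ((1 + u * 2) * (1 + u * 2) , solve (u ∷ []))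
  by-residue 3 u _ = inj₂ (1 + u * 3 + u * u * 2 , solve (u ∷ []))
  by-residue (suc (suc (suc (suc _)))) _ (s≤s (s≤s (s≤s (s≤s ()))))

square+m≡7[mod8]⇒m≡3[mod4]⊎m≡6[mod8] : ∀ w m → (w * w + m) % 8 ≡ 7 →
                                       m % 4 ≡ 3 ⊎ ∃[ a ] m ≡ a * 2 × a % 4 ≡ 3
square+m≡7[mod8]⇒m≡3[mod4]⊎m≡6[mod8] w m sum≡7 with square≡0[mod4]⊎1[mod8] w
... | inj₁ (t , w²≡4t) = inj₁ (begin
  m % 4                  ≡⟨ [m+kn]%n≡m%n m t 4 ⟨
  (m + t * 4) % 4        ≡⟨ cong (_% 4) (trans (+-comm m (t * 4)) (cong (_+ m) (sym w²≡4t))) ⟩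
  (w * w + m) % 4        ≡⟨ m∣n⇒o%n%m≡o%m 4 8 (w * w + m) (divides 2 refl) ⟨
  (w * w + m) % 8 % 4    ≡⟨ cong (_% 4) sum≡7 ⟩
  3                      ∎)
  where open ≡-Reasoning
... | inj₂ (t , w²≡1+8t) = inj₂ (3 + s * 4 , m≡6+8s , [m+kn]%n≡m%n 3 s 4)
  where
  1+m≡7 : suc m % 8 ≡ 7
  1+m≡7 = trans (sym ([m+kn]%n≡m%n (suc m) t 8))
               (trans (cong (_% 8) (trans rearrange (cong (_+ m) (sym w²≡1+8t)))) sum≡7)
    where
    rearrange : suc m + t * 8 ≡ 1 + t * 8 + m
    rearrange = solve (m ∷ t ∷ [])
  s = suc m / 8
  m≡6+8s : m ≡ (3 + s * 4) * 2
  m≡6+8s = trans (suc-injective (trans (m≡m%n+[m/n]*n (suc m) 8) (cong (_+ s * 8) 1+m≡7)))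
                 (sym (trans (*-distribʳ-+ 2 3 (s * 4)) (cong (6 +_) (*-assoc s 4 2))))

difference-of-squares : ∀ {s c N} → s + c * c ≡ N * N → ∃[ d ] N ≡ c + d × s ≡ d * (d + 2 * c)
difference-of-squares {s} {c} {N} s+c²≡N² = N ∸ c , N≡c+d , +-cancelʳ-≡ (c * c) s _ (begin
  s + c * c                          ≡⟨ s+c²≡N² ⟩
  N * N                              ≡⟨ cong (λ k → k * k) N≡c+d ⟩
  (c + (N ∸ c)) * (c + (N ∸ c))      ≡⟨ expand c (N ∸ c) ⟩
  (N ∸ c) * (N ∸ c + 2 * c) + c * c  ∎)
  where
  open ≡-Reasoning
  expand : ∀ c d → (c + d) * (c + d) ≡ d * (d + 2 * c) + c * c
  expand = solve-∀
  c≤N : c ≤ N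
  c≤N = ≮⇒≥ λ N<c → <⇒≱ (*-mono-< N<c N<c) (≤-trans (m≤n+m (c * c) s) (≤-reflexive s+c²≡N²))
  N≡c+d : N ≡ c + (N ∸ c)
  N≡c+d = sym (m+[n∸m]≡n c≤N)

prime∣a∧∣a+2w²⇒∣w : ∀ {q a w} → Prime q → 2 < q → q ∣ a → q ∣ a + 2 * (w * w) → q ∣ w
prime∣a∧∣a+2w²⇒∣w q-prime 2<q q∣a q∣a+2w² =
  prime∣m*m⇒∣m q-prime (∣m*n∧∤m⇒∣n q-prime (∣m+n∣m⇒∣n q∣a+2w² q∣a) (>⇒∤ 2<q))

noCommonPrime-difference : ∀ {w a} → NoCommonPrime≡3[mod4] (w * w + a) w →
                           NoCommonPrime≡3[mod4] a (a + 2 * (w * w))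
noCommonPrime-difference {w} no-common q-prime q≡3 q∣a q∣a+2w² =
  no-common q-prime q≡3 (∣m∣n⇒∣m+n (∣m⇒∣m*n w q∣w) q∣a) q∣w
  where q∣w = prime∣a∧∣a+2w²⇒∣w q-prime (≡3[mod4]⇒>2 q≡3) q∣a q∣a+2w²

m²+n²+w⁴≢N² : ∀ m n {w N} → N % 8 ≡ 7 → NoCommonPrime≡3[mod4] N w →
              m * m + n * n + w * w * (w * w) ≢ N * N
m²+n²+w⁴≢N² m n {w} {N} N≡7 no-common eq with difference-of-squares {m * m + n * n} {w * w} {N} eq
... | A , refl , m²+n²≡A[A+2w²] with square+m≡7[mod8]⇒m≡3[mod4]⊎m≡6[mod8] w A N≡7
...   | inj₁ A≡3 = m²+n²≢a*b m n A≡3 (noCommonPrime-difference no-common) m²+n²≡A[A+2w²]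
...   | inj₂ (a , refl , a≡3) =
  m²+n²≢a*b m n {a} a≡3 (noCommonPrime-2*ʳ (noCommonPrime-∣ˡ (m∣m*n 2) (noCommonPrime-difference no-common)))
                (trans m²+n²≡A[A+2w²] (*-assoc a 2 _))

primeFactors≡1[mod4]⇒∤ : ∀ {n q} → (n ≡ 1 ⊎ (∀ q → Prime q → q ∣ n → q % 4 ≡ 1)) →
                         Prime q → q % 4 ≡ 3 → ¬ q ∣ n
primeFactors≡1[mod4]⇒∤ (inj₁ refl)       _       q≡3 q∣1 =
  >⇒∤ (<-trans (n<1+n 1) (≡3[mod4]⇒>2 q≡3)) q∣1
primeFactors≡1[mod4]⇒∤ (inj₂ factors≡1) q-prime q≡3 q∣n
  with () ← trans (sym (factors≡1 _ q-prime q∣n)) q≡3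

square-≤⇒≤ : ∀ {m n} → m * m ≤ n * n → m ≤ n
square-≤⇒≤ m²≤n² = ≮⇒≥ λ n<m → <⇒≱ (*-mono-< n<m n<m) m²≤n²

square-<⇒< : ∀ {m n} → m * m < n * n → m < n
square-<⇒< m²<n² = ≰⇒> λ n≤m → <⇒≱ m²<n² (*-mono-≤ n≤m n≤m)

theorem2 : (k p n : ℕ) → 0 < k → 4 ∣ k → Prime p → p % 8 ≡ 7 → 0 < n → n % 8 ≡ 1 → n < p
    → (n ≡ 1 ⊎ (∀ q → Prime q → q ∣ n → q % 4 ≡ 1))
    → ¬ (∃[ x ] ∃[ y ] ∃[ z ] (0 < x × 0 < y × 0 < z × x ^ 2 + y ^ 2 + z ^ k ≡ (n * p) ^ 2))
theorem2 k p n _ (divides j refl) p-prime p≡7 _ n≡1 n<p n-factors (x , y , z , _ , _ , z>0 , eq) =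
  m²+n²+w⁴≢N² x y N≡7 no-common squares
  where
  instance _ = prime⇒nonZero p-prime
  w = z ^ j
  N = n * p
  squares : x * x + y * y + w * w * (w * w) ≡ N * N
  squares = begin
    x * x + y * y + w * w * (w * w)  ≡⟨ cong₂ (λ u v → u + v + w * w * (w * w)) (m^2≡m*m x) (m^2≡m*m y) ⟨
    x ^ 2 + y ^ 2 + w * w * (w * w)  ≡⟨ cong (x ^ 2 + y ^ 2 +_) z^[4j]≡w⁴ ⟨
    x ^ 2 + y ^ 2 + z ^ (j * 4)      ≡⟨ eq ⟩
    N ^ 2                            ≡⟨ m^2≡m*m N ⟩
    N * N                            ∎
    where
    open ≡-Reasoning
    z^[4j]≡w⁴ : z ^ (j * 4) ≡ w * w * (w * w)
    z^[4j]≡w⁴ = trans (sym (^-*-assoc z j 4)) (trans (^-distribˡ-+-* w 2 2) (cong₂ _*_ (m^2≡m*m w) (m^2≡m*m w)))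
  N≡7 : N % 8 ≡ 7
  N≡7 = trans (%-distribˡ-* n p 8) (cong₂ (λ u v → u * v % 8) n≡1 p≡7)
  w<p : w < p
  w<p = square-<⇒< (≤-<-trans (square-≤⇒≤ (≤-trans (m≤n+m _ _) (≤-reflexive squares))) (*-monoˡ-< p n<p))
  no-common : NoCommonPrime≡3[mod4] N w
  no-common q-prime q≡3 q∣N q∣w with euclidsLemma n p q-prime q∣N
  ... | inj₁ q∣n = primeFactors≡1[mod4]⇒∤ n-factors q-prime q≡3 q∣n
  ... | inj₂ q∣p with prime⇒irreducible p-prime q∣p
  ...   | inj₁ refl with () ← q≡3
  ...   | inj₂ refl = >⇒∤ {{m^n≢0 z j {{>-nonZero z>0}}}} w<p q∣w
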